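{- An integer $n>1$ is a weak Carmichael number which is not a Carmichael number if and only if $$\sum_{1\le k\le n-1,\ \gcd(k,n)=1} k^{n-1}\equiv \varphi(n)+\mu(n)\pmod{n}.$$
   Context: $\varphi$ is Euler's totient function and $\mu$ the Möbius function. A composite positive integer $n$ is called a weak Carmichael number if $\sum_{1\le k\le n-1,\ \gcd(k,n)=1} k^{n-1}\equiv \varphi(n)\pmod{n}$. A Carmichael number is a composite positive integer $n$ with $a^{n-1}\equiv 1\pmod n$ for all integers $a$ coprime to $n$. -}

module Defs where

open import Data.Nat using (ℕ; zero; suc; _+_; _*_; _∸_; _^_; _≡ᵇ_)
open import Data.Nat.GCD using (gcd)
open import Data.Nat.Primality using (Prime; prime?; Composite)
open import Data.Nat.Divisibility using (_∣?_)
open import Data.Integer as ℤ using (ℤ; +_; -_; _-_)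
open import Data.Integer.Divisibility as ℤD using ()
open import Data.List using (List; map; upTo; foldr)
open import Data.Nat.ListAction using (sum)
open import Data.Bool using (if_then_else_)
open import Relation.Nullary.Decidable using (⌊_⌋)

range1 : ℕ → List ℕ
range1 m = map suc (upTo m)

_≡_[mod_] : ℤ → ℤ → ℕ → Set
a ≡ b [mod n ] = (+ n) ℤD.∣ (a - b)

φ : ℕ → ℕ
φ n = sum (map (λ k → if gcd k n ≡ᵇ 1 then 1 else 0) (range1 n))

μ : ℕ → ℤ
μ n = foldr ℤ._*_ (+ 1) (map factor (range1 n))
  where
  factor : ℕ → ℤ
  factor p = if ⌊ prime? p ⌋
             then (if ⌊ (p * p) ∣? n ⌋ then + 0
                   else (if ⌊ p ∣? n ⌋ then - (+ 1) else + 1))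
             else + 1

S : ℕ → ℕ
S n = sum (map (λ k → if gcd k n ≡ᵇ 1 then k ^ (n ∸ 1) else 0) (range1 (n ∸ 1)))

WeakCarmichael : ℕ → Set
WeakCarmichael n = Composite n × (+ S n) ≡ (+ φ n) [mod n ]
  where open import Data.Product using (_×_)

Carmichael : ℕ → Set
Carmichael n = Composite n ×
  (∀ (a : ℤ) → gcd ℤ.∣ a ∣ n ≡ 1 → (a ℤ.^ (n ∸ 1)) ≡ (+ 1) [mod n ])
  where open import Data.Product using (_×_)
        open import Relation.Binary.PropositionalEquality using (_≡_)

module Submission where

-- Write n = p r with p prime. Splitting k < n as k = j r + i (j < p, i < r), k is a unit modulo n
-- iff i is a unit modulo r and p ∤ k, so modulo p the sum S(n) of k^(n-1) over the units becomes a
-- combination of the sums Σ_{j<p} (j r + i)^(n-1). By Fermat and the binomial theorem these vanish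
-- when p - 1 ∤ n - 1, because the power sums Σ_{j<p} j^l vanish for l < p - 1; when p - 1 ∣ n - 1
-- every unit contributes 1, so S(n) ≡ φ(n). Counting the same way gives φ(q r) = (q - 1) φ(r) for q ∤ r.
--
-- If p² ∣ n then μ(n) = 0, n is composite, and n is not Carmichael since (1 + n/p)^(n-1) ≡ 1 - n/p,
-- so both sides of the equivalence say S(n) ≡ φ(n). If n is squarefree, both sides fail. A weak
-- Carmichael n satisfies Korselt's criterion, hence is Carmichael: a prime p ∣ n with p - 1 ∤ n - 1
-- would divide S(n) ≡ φ(n) = ∏ (q - 1), giving a larger such prime q. And S(n) ≡ φ(n) + μ(n) fails:
-- if some p - 1 ∣ n - 1 it gives p ∣ μ(n) = ±1, and otherwise S(n) ≡ 0 (mod n) forces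
-- φ(n) ∈ {1, n - 1}, so that every p - 1 ∣ φ(n) ∣ n - 1 after all.

open import Defs
open import Data.Nat using (ℕ; _<_)
open import Data.Integer using (+_; _+_)
open import Data.Product using (_×_)
open import Relation.Nullary using (¬_)
open import Function.Bundles using (_⇔_)

open import Data.Nat as ℕ using (zero; suc; _≤_; z≤n; s≤s; NonZero; _≡ᵇ_)
import Data.Nat.Properties as ℕ
open import Data.Nat.Properties using (_!*_!≢0)
open import Data.Nat.Divisibility
  using ( _∣_; divides; _∣?_; ∣-refl; ∣-trans; _∣0; 1∣_; ∣1⇒≡1; ∣⇒≤; m∣m*n; n∣m*n
        ; ∣m∣n⇒∣m+n; ∣m+n∣m⇒∣n; ∣n⇒∣m*n; *-monoʳ-∣)
open import Data.Nat.Divisibility.Core using (hasNonTrivialDivisor)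
open import Data.Nat.DivMod using (_%_; _/_; m≡m%n+[m/n]*n; m%n<n; m*[n/m]≡n)
open import Data.Nat.Combinatorics using (_C_; nCn≡1; nCk≡nC[n∸k]; nC1≡n; k![n∸k]!∣n!)
open import Data.Nat.Combinatorics.Specification using (nCk≡n!/k![n-k]!)
open import Data.Nat.GCD using (gcd)
open import Data.Nat.LCM using (lcm; lcm-least; gcd*lcm)
open import Data.Nat.Coprimality using (Coprime; coprime-divisor; gcd≡1⇒coprime; coprime⇒gcd≡1)
import Data.Nat.Coprimality as Cop
open import Data.Nat.Primality
  using (Prime; Composite; prime?; euclidsLemma; prime⇒nonZero; prime⇒nonTrivial; prime⇒irreducible)
open import Data.Nat.Primality.Factorisation using (factorise)
open import Data.Nat.ListAction using (product) renaming (sum to sumℕ)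
open import Data.Nat.Induction using (<-rec; <-wellFounded)
import Data.Nat.Tactic.RingSolver as ℕ-Solver
open import Data.Integer as ℤ using (ℤ; -_; _-_; _*_; _^_; -[1+_])
import Data.Integer.Properties as ℤ
import Data.Integer.Divisibility.Signed as ℤ∣
open import Data.Integer.DivMod using (_%ℕ_; _/ℕ_; n%ℕd<d; a≡a%ℕn+[a/ℕn]*n)
open import Data.Integer.Tactic.RingSolver using (solve-∀)
open import Data.Fin using (toℕ)
open import Data.List using (map; applyUpTo; foldr; []; _∷_)
open import Data.List.Membership.Propositional using (_∈_)
open import Data.List.Membership.Propositional.Properties using (∈-map⁺; ∈-upTo⁺)
open import Data.List.Relation.Unary.Any using (here; there)
open import Data.List.Relation.Unary.All using ([]; _∷_)
open import Data.Bool using (true; false; T; if_then_else_)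
open import Data.Unit using (tt)
open import Data.Empty using (⊥-elim)
open import Data.Sum using (_⊎_; inj₁; inj₂; [_,_]′)
open import Data.Product using (∃-syntax; _,_)
open import Function using (_∘_; id)
open import Function.Bundles using (mk⇔)
open import Induction.WellFounded using (Acc; acc)
open import Relation.Nullary using (yes; no)
open import Relation.Nullary.Decidable using (_×-dec_; ⌊_⌋)
open import Relation.Binary.Bundles using (Setoid)
open import Relation.Binary.PropositionalEquality
  using (_≡_; _≢_; refl; sym; trans; cong; cong₂; subst; module ≡-Reasoning)
open import Algebra.Properties.Monoid.Sum ℤ.+-0-monoid using (sum; sum-cong-≗)
import Algebra.Properties.CommutativeSemiring.Binomial ℤ.+-*-commutativeSemiring as Binomial
import Algebra.Definitions.RawSemiring ℤ.+-*-rawSemiring as RS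

∣∧<⇒≡0 : ∀ {n d} → n ∣ d → d < n → d ≡ 0
∣∧<⇒≡0 {d = zero}  _   _   = refl
∣∧<⇒≡0 {d = suc _} n∣d d<n = ⊥-elim (ℕ.<⇒≱ d<n (∣⇒≤ n∣d))

prime⇒2≤ : ∀ {p} → Prime p → 2 ≤ p
prime⇒2≤ {p} p-prime = ℕ.nonTrivial⇒n>1 p {{prime⇒nonTrivial p-prime}}

prime≢1 : ∀ {p} → Prime p → p ≢ 1
prime≢1 p-prime p≡1 = ℕ.<-irrefl (sym p≡1) (prime⇒2≤ p-prime)

prime∤1 : ∀ {p} → Prime p → ¬ p ∣ 1
prime∤1 p-prime = prime≢1 p-prime ∘ ∣1⇒≡1

∣pred⇒< : ∀ {p q} → Prime q → p ∣ q ℕ.∸ 1 → p < q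
∣pred⇒< {p} {suc (suc q)} _ p∣q-1 = s≤s (∣⇒≤ p∣q-1)

∣∧∣pred⇒≡1 : ∀ {d n} → 0 < n → d ∣ n → d ∣ n ℕ.∸ 1 → d ≡ 1
∣∧∣pred⇒≡1 {d} {suc m} _ d∣n d∣m = ∣1⇒≡1 (∣m+n∣m⇒∣n (subst (d ∣_) (ℕ.+-comm 1 m) d∣n) d∣m)

-- Congruences of integers

-- A record, unlike _≡_[mod_], lets a and b be inferred from the type.
infix 4 _≈_[mod_]
record _≈_[mod_] (a b : ℤ) (n : ℕ) : Set where
  constructor mk≈
  field divides-difference : + n ℤ∣.∣ a - b
open _≈_[mod_]

module _ {n : ℕ} where

  ≈-refl : ∀ {a} → a ≈ a [mod n ]
  ≈-refl {a} = mk≈ (ℤ∣.divides (+ 0) (ℤ.+-inverseʳ a))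

  ≡⇒≈ : ∀ {a b} → a ≡ b → a ≈ b [mod n ]
  ≡⇒≈ refl = ≈-refl

  ≈-sym : ∀ {a b} → a ≈ b [mod n ] → b ≈ a [mod n ]
  ≈-sym {a} {b} (mk≈ d) = mk≈ (subst (+ n ℤ∣.∣_) (difference-swap a b) (ℤ∣.∣m⇒∣-m d))
    where difference-swap : ∀ a b → - (a - b) ≡ b - a
          difference-swap = solve-∀

  ≈-trans : ∀ {a b c} → a ≈ b [mod n ] → b ≈ c [mod n ] → a ≈ c [mod n ]
  ≈-trans {a} {b} {c} (mk≈ d) (mk≈ e) = mk≈ (subst (+ n ℤ∣.∣_) (telescope a b c) (ℤ∣.∣m∣n⇒∣m+n d e))
    where telescope : ∀ a b c → (a - b) + (b - c) ≡ a - c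
          telescope = solve-∀

  ≈-+ : ∀ {a b c d} → a ≈ b [mod n ] → c ≈ d [mod n ] → a + c ≈ b + d [mod n ]
  ≈-+ {a} {b} {c} {d} (mk≈ d₁) (mk≈ d₂) = mk≈ (subst (+ n ℤ∣.∣_) (regroup a b c d) (ℤ∣.∣m∣n⇒∣m+n d₁ d₂))
    where regroup : ∀ a b c d → (a - b) + (c - d) ≡ (a + c) - (b + d)
          regroup = solve-∀

  ≈-* : ∀ {a b c d} → a ≈ b [mod n ] → c ≈ d [mod n ] → a * c ≈ b * d [mod n ]
  ≈-* {a} {b} {c} {d} (mk≈ d₁) (mk≈ d₂) =
    mk≈ (subst (+ n ℤ∣.∣_) (regroup a b c d) (ℤ∣.∣m∣n⇒∣m+n (ℤ∣.∣m⇒∣m*n c d₁) (ℤ∣.∣n⇒∣m*n b d₂)))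
    where regroup : ∀ a b c d → (a - b) * c + b * (c - d) ≡ a * c - b * d
          regroup = solve-∀

  ≈-^ : ∀ {a b} k → a ≈ b [mod n ] → a ^ k ≈ b ^ k [mod n ]
  ≈-^ zero    _   = ≈-refl
  ≈-^ (suc k) a≈b = ≈-* a≈b (≈-^ k a≈b)

  ≈0⇒∣ : ∀ {a} → a ≈ + 0 [mod n ] → n ∣ ℤ.∣ a ∣
  ≈0⇒∣ {a} (mk≈ d) = subst (λ x → n ∣ ℤ.∣ x ∣) (ℤ.+-identityʳ a) (ℤ∣.∣⇒∣ᵤ d)

  ∣⇒≈0 : ∀ {a} → n ∣ ℤ.∣ a ∣ → a ≈ + 0 [mod n ]
  ∣⇒≈0 {a} d = mk≈ (ℤ∣.∣ᵤ⇒∣ (subst (λ x → n ∣ ℤ.∣ x ∣) (sym (ℤ.+-identityʳ a)) d))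

  multiple≈0 : ∀ x → x * + n ≈ + 0 [mod n ]
  multiple≈0 x = mk≈ (ℤ∣.divides x (ℤ.+-identityʳ (x * + n)))

  a-b≈0⇒a≈b : ∀ {a b} → a - b ≈ + 0 [mod n ] → a ≈ b [mod n ]
  a-b≈0⇒a≈b {a} {b} (mk≈ d) = mk≈ (subst (+ n ℤ∣.∣_) (ℤ.+-identityʳ (a - b)) d)

  a≈b⇒a-b≈0 : ∀ {a b} → a ≈ b [mod n ] → a - b ≈ + 0 [mod n ]
  a≈b⇒a-b≈0 {a} {b} (mk≈ d) = mk≈ (subst (+ n ℤ∣.∣_) (sym (ℤ.+-identityʳ (a - b))) d)

  ≈-%ℕ : ∀ a .{{_ : NonZero n}} → a ≈ + (a %ℕ n) [mod n ]
  ≈-%ℕ a = ≈-sym (a-b≈0⇒a≈b (≈-trans (≡⇒≈ quotient-form) (multiple≈0 (- (a /ℕ n)))))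
    where
    open ≡-Reasoning
    quotient-form : + (a %ℕ n) - a ≡ - (a /ℕ n) * + n
    quotient-form = begin
      + (a %ℕ n) - a                               ≡⟨ cong (λ z → + (a %ℕ n) - z) (a≡a%ℕn+[a/ℕn]*n a n) ⟩
      + (a %ℕ n) - (+ (a %ℕ n) + (a /ℕ n) * + n) ≡⟨ cancel (+ (a %ℕ n)) (a /ℕ n) (+ n) ⟩
      - (a /ℕ n) * + n                           ∎
      where cancel : ∀ r q m → r - (r + q * m) ≡ - q * m
            cancel = solve-∀

  private
    ≈-small-≥ : ∀ {x y} → x < n → y ≤ x → + x ≈ + y [mod n ] → x ≡ y
    ≈-small-≥ {x} {y} x<n y≤x x≈y = ℕ.≤-antisym (ℕ.m∸n≡0⇒m≤n x∸y≡0) y≤x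
      where
      n∣x∸y : n ∣ x ℕ.∸ y
      n∣x∸y = subst (λ z → n ∣ ℤ.∣ z ∣) (trans (ℤ.m-n≡m⊖n x y) (ℤ.⊖-≥ y≤x))
                (≈0⇒∣ (a≈b⇒a-b≈0 x≈y))
      x∸y≡0 : x ℕ.∸ y ≡ 0
      x∸y≡0 = ∣∧<⇒≡0 n∣x∸y (ℕ.≤-<-trans (ℕ.m∸n≤m x y) x<n)

  ≈-small : ∀ {a b} → a < n → b < n → + a ≈ + b [mod n ] → a ≡ b
  ≈-small {a} {b} a<n b<n a≈b with ℕ.≤-total a b
  ... | inj₁ a≤b = sym (≈-small-≥ b<n a≤b (≈-sym a≈b))
  ... | inj₂ b≤a = ≈-small-≥ a<n b≤a a≈b

≈-resp-∣ : ∀ {m n a b} → m ∣ n → a ≈ b [mod n ] → a ≈ b [mod m ]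
≈-resp-∣ m∣n (mk≈ d) = mk≈ (ℤ∣.∣-trans (ℤ∣.∣ᵤ⇒∣ m∣n) d)

≈0-euclid : ∀ {p a b} → Prime p → a * b ≈ + 0 [mod p ] → a ≈ + 0 [mod p ] ⊎ b ≈ + 0 [mod p ]
≈0-euclid {p} {a} {b} p-prime ab≈0
  with euclidsLemma ℤ.∣ a ∣ ℤ.∣ b ∣ p-prime (subst (p ∣_) (ℤ.abs-* a b) (≈0⇒∣ ab≈0))
... | inj₁ p∣a = inj₁ (∣⇒≈0 p∣a)
... | inj₂ p∣b = inj₂ (∣⇒≈0 p∣b)

≈0⇒*≈0 : ∀ {n b} a → b ≈ + 0 [mod n ] → a * b ≈ + 0 [mod n ]
≈0⇒*≈0 a b≈0 = ≈-trans (≈-* (≈-refl {a = a}) b≈0) (≡⇒≈ (ℤ.*-zeroʳ a))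

∣⇒*≈0 : ∀ {n c} z → n ∣ c → + c * z ≈ + 0 [mod n ]
∣⇒*≈0 {c = c} z n∣c = ≈-trans (≈-* (∣⇒≈0 {a = + c} n∣c) (≈-refl {a = z})) (≡⇒≈ (ℤ.*-zeroˡ z))

∣⇒^≈0 : ∀ {p x e} → p ∣ x → 0 < e → (+ x) ^ e ≈ + 0 [mod p ]
∣⇒^≈0 {e = suc e} p∣x _ = ∣⇒*≈0 (_ ^ e) p∣x

≈-+-cancelʳ : ∀ {n a b} c → a + c ≈ b + c [mod n ] → a ≈ b [mod n ]
≈-+-cancelʳ {n} {a} {b} c (mk≈ d) = mk≈ (subst (+ n ℤ∣.∣_) (cancel a b c) d)
  where cancel : ∀ a b c → (a + c) - (b + c) ≡ a - b
        cancel = solve-∀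

≈-*-cancelʳ : ∀ {p a b c} → Prime p → ¬ c ≈ + 0 [mod p ] → a * c ≈ b * c [mod p ] → a ≈ b [mod p ]
≈-*-cancelʳ {p} {a} {b} {c} p-prime c≉0 ac≈bc =
  [ a-b≈0⇒a≈b , ⊥-elim ∘ c≉0 ]′
    (≈0-euclid p-prime (≈-trans (≡⇒≈ (factor a b c)) (a≈b⇒a-b≈0 ac≈bc)))
  where factor : ∀ a b c → (a - b) * c ≡ a * c - b * c
        factor = solve-∀

≡[mod]⇒≈ : ∀ {a b n} → a ≡ b [mod n ] → a ≈ b [mod n ]
≡[mod]⇒≈ d = mk≈ (ℤ∣.∣ᵤ⇒∣ d)

≈⇒≡[mod] : ∀ {a b n} → a ≈ b [mod n ] → a ≡ b [mod n ]
≈⇒≡[mod] (mk≈ d) = ℤ∣.∣⇒∣ᵤ d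

≈-setoid : ℕ → Setoid _ _
≈-setoid n = record
  { Carrier = ℤ
  ; _≈_ = λ a b → a ≈ b [mod n ]
  ; isEquivalence = record { refl = ≈-refl ; sym = ≈-sym ; trans = ≈-trans }
  }

module ≈-Reasoning (n : ℕ) where
  open import Relation.Binary.Reasoning.Setoid (≈-setoid n) public

-- Finite sums

Σ : ℕ → (ℕ → ℤ) → ℤ
Σ zero    f = + 0
Σ (suc n) f = f 0 + Σ n (f ∘ suc)

module _ where
  open ≡-Reasoning

  Σ-cong : ∀ n {f g : ℕ → ℤ} → (∀ k → k < n → f k ≡ g k) → Σ n f ≡ Σ n g
  Σ-cong zero    _   = refl
  Σ-cong (suc n) f≡g = cong₂ _+_ (f≡g 0 (s≤s z≤n)) (Σ-cong n (λ k k<n → f≡g (suc k) (s≤s k<n)))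

  Σ-cong-≈ : ∀ n {m} {f g : ℕ → ℤ} → (∀ k → k < n → f k ≈ g k [mod m ]) → Σ n f ≈ Σ n g [mod m ]
  Σ-cong-≈ zero    _   = ≈-refl
  Σ-cong-≈ (suc n) f≈g = ≈-+ (f≈g 0 (s≤s z≤n)) (Σ-cong-≈ n (λ k k<n → f≈g (suc k) (s≤s k<n)))

  Σ-≈0 : ∀ n {m} {f : ℕ → ℤ} → (∀ k → k < n → f k ≈ + 0 [mod m ]) → Σ n f ≈ + 0 [mod m ]
  Σ-≈0 zero    _   = ≈-refl
  Σ-≈0 (suc n) f≈0 = ≈-+ (f≈0 0 (s≤s z≤n)) (Σ-≈0 n (λ k k<n → f≈0 (suc k) (s≤s k<n)))

  Σ-last : ∀ n (f : ℕ → ℤ) → Σ (suc n) f ≡ Σ n f + f n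
  Σ-last zero    f = ℤ.+-comm (f 0) (+ 0)
  Σ-last (suc n) f = trans (cong (_+_ (f 0)) (Σ-last n (f ∘ suc))) (sym (ℤ.+-assoc (f 0) _ _))

  Σ-+ : ∀ a b (f : ℕ → ℤ) → Σ (a ℕ.+ b) f ≡ Σ a f + Σ b (λ k → f (a ℕ.+ k))
  Σ-+ zero    b f = sym (ℤ.+-identityˡ _)
  Σ-+ (suc a) b f = trans (cong (_+_ (f 0)) (Σ-+ a b (f ∘ suc))) (sym (ℤ.+-assoc (f 0) _ _))

  Σ-distrib : ∀ n (f g : ℕ → ℤ) → Σ n (λ k → f k + g k) ≡ Σ n f + Σ n g
  Σ-distrib zero    f g = refl
  Σ-distrib (suc n) f g = trans (cong (_+_ (f 0 + g 0)) (Σ-distrib n (f ∘ suc) (g ∘ suc)))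
                                (middle-swap (f 0) (g 0) _ _)
    where middle-swap : ∀ a b c d → a + b + (c + d) ≡ a + c + (b + d)
          middle-swap = solve-∀

  *-distribˡ-Σ : ∀ n c (f : ℕ → ℤ) → c * Σ n f ≡ Σ n (λ k → c * f k)
  *-distribˡ-Σ zero    c f = ℤ.*-zeroʳ c
  *-distribˡ-Σ (suc n) c f = trans (ℤ.*-distribˡ-+ c (f 0) _) (cong (_+_ (c * f 0)) (*-distribˡ-Σ n c (f ∘ suc)))

  Σ-const : ∀ n c → Σ n (λ _ → c) ≡ + n * c
  Σ-const zero    c = sym (ℤ.*-zeroˡ c)
  Σ-const (suc n) c = trans (cong (_+_ c) (Σ-const n c))
    (sym (trans (ℤ.*-distribʳ-+ c (+ 1) (+ n)) (cong (_+ (+ n * c)) (ℤ.*-identityˡ c))))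

  Σ-swap : ∀ a b (f : ℕ → ℕ → ℤ) → Σ a (λ i → Σ b (f i)) ≡ Σ b (λ j → Σ a (λ i → f i j))
  Σ-swap zero    b f = sym (trans (Σ-const b (+ 0)) (ℤ.*-zeroʳ (+ b)))
  Σ-swap (suc a) b f = begin
    Σ b (f 0) + Σ a (λ i → Σ b (f (suc i)))           ≡⟨ cong (_+_ (Σ b (f 0))) (Σ-swap a b (f ∘ suc)) ⟩
    Σ b (f 0) + Σ b (λ j → Σ a (λ i → f (suc i) j))   ≡⟨ Σ-distrib b (f 0) _ ⟨
    Σ b (λ j → f 0 j + Σ a (λ i → f (suc i) j))       ∎

  Σ-blocks : ∀ q r (f : ℕ → ℤ) → Σ (q ℕ.* r) f ≡ Σ q (λ j → Σ r (λ i → f (j ℕ.* r ℕ.+ i)))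
  Σ-blocks zero    r f = refl
  Σ-blocks (suc q) r f = begin
    Σ (r ℕ.+ q ℕ.* r) f                                          ≡⟨ Σ-+ r (q ℕ.* r) f ⟩
    Σ r f + Σ (q ℕ.* r) (λ k → f (r ℕ.+ k))                      ≡⟨ cong (_+_ (Σ r f)) (Σ-blocks q r _) ⟩
    Σ r f + Σ q (λ j → Σ r (λ i → f (r ℕ.+ (j ℕ.* r ℕ.+ i))))     ≡⟨ cong (_+_ (Σ r f)) (Σ-cong q λ j _ →
                                                                     Σ-cong r λ i _ → cong f (sym (ℕ.+-assoc r _ i))) ⟩
    Σ r f + Σ q (λ j → Σ r (λ i → f (suc j ℕ.* r ℕ.+ i)))         ∎

  Σ-punctured : ∀ n j₀ (f : ℕ → ℤ) → j₀ < n → f j₀ ≡ + 0 → (∀ j → j < n → j ≢ j₀ → f j ≡ + 1) →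
                Σ n f ≡ + (n ℕ.∸ 1)
  Σ-punctured (suc n) zero f _ f0≡0 f≡1 = begin
    f 0 + Σ n (f ∘ suc)             ≡⟨ cong₂ _+_ f0≡0 (Σ-cong n (λ j j<n → f≡1 (suc j) (s≤s j<n) λ ())) ⟩
    + 0 + Σ n (λ _ → + 1)           ≡⟨ ℤ.+-identityˡ _ ⟩
    Σ n (λ _ → + 1)                 ≡⟨ Σ-const n (+ 1) ⟩
    + n * + 1                       ≡⟨ ℤ.*-identityʳ (+ n) ⟩
    + n                             ∎
  Σ-punctured (suc (suc n)) (suc j₀) f (s≤s j₀<n) fj₀≡0 f≡1 =
    cong₂ _+_ (f≡1 0 (s≤s z≤n) λ ())
              (Σ-punctured (suc n) j₀ (f ∘ suc) j₀<n fj₀≡0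
                 (λ j j<n j≢j₀ → f≡1 (suc j) (s≤s j<n) (j≢j₀ ∘ ℕ.suc-injective)))

  Σ≤n : ∀ m (f : ℕ → ℤ) → (∀ k → f k ℤ.≤ + 1) → Σ m f ℤ.≤ + m
  Σ≤n zero    f _    = ℤ.≤-refl
  Σ≤n (suc m) f f≤1 = ℤ.+-mono-≤ (f≤1 0) (Σ≤n m (f ∘ suc) (f≤1 ∘ suc))

  Σ-as-sum : ∀ n (f : ℕ → ℤ) → Σ n f ≡ sum {n} (f ∘ toℕ)
  Σ-as-sum zero    f = refl
  Σ-as-sum (suc n) f = cong (_+_ (f 0)) (Σ-as-sum n (f ∘ suc))

  Σ-telescope : ∀ n (g : ℕ → ℤ) → Σ n (λ k → g (suc k) - g k) ≡ g n - g 0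
  Σ-telescope zero    g = sym (ℤ.+-inverseʳ (g 0))
  Σ-telescope (suc n) g = begin
    Σ (suc n) (λ k → g (suc k) - g k)          ≡⟨ Σ-last n _ ⟩
    Σ n (λ k → g (suc k) - g k) + (g (suc n) - g n) ≡⟨ cong (_+ (g (suc n) - g n)) (Σ-telescope n g) ⟩
    g n - g 0 + (g (suc n) - g n)              ≡⟨ collapse (g n) (g 0) (g (suc n)) ⟩
    g (suc n) - g 0                            ∎
    where collapse : ∀ x y z → x - y + (z - x) ≡ z - y
          collapse = solve-∀

  Σ-rotate : ∀ n (f : ℕ → ℤ) → f n ≡ f 0 → Σ n (f ∘ suc) ≡ Σ n f
  Σ-rotate zero    f _   = refl
  Σ-rotate (suc n) f fn≡f0 = begin
    Σ (suc n) (f ∘ suc)        ≡⟨ Σ-last n (f ∘ suc) ⟩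
    Σ n (f ∘ suc) + f (suc n)  ≡⟨ cong (_+_ (Σ n (f ∘ suc))) fn≡f0 ⟩
    Σ n (f ∘ suc) + f 0        ≡⟨ ℤ.+-comm _ (f 0) ⟩
    Σ (suc n) f                ∎

-- Fermat's little theorem

pos-^ : ∀ a k → + (a ℕ.^ k) ≡ (+ a) ^ k
pos-^ a zero    = refl
pos-^ a (suc k) = trans (ℤ.pos-* a (a ℕ.^ k)) (cong (+ a *_) (pos-^ a k))

pos-*-+ : ∀ j a b → + (j ℕ.* a ℕ.+ b) ≡ + j * + a + + b
pos-*-+ j a b = trans (ℤ.pos-+ (j ℕ.* a) b) (cong (_+ + b) (ℤ.pos-* j a))

^-distribʳ-* : ∀ x y n → (x * y) ^ n ≡ x ^ n * y ^ n
^-distribʳ-* x y zero    = refl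
^-distribʳ-* x y (suc n) = trans (cong (x * y *_) (^-distribʳ-* x y n)) (interchange x y (x ^ n) (y ^ n))
  where interchange : ∀ a b c d → a * b * (c * d) ≡ a * c * (b * d)
        interchange = solve-∀

binomial : ∀ n x y → (x + y) ^ n ≡ Σ (suc n) (λ k → + (n C k) * (x ^ k * y ^ (n ℕ.∸ k)))
binomial n x y = begin
  (x + y) ^ n                      ≡⟨ ^-as-semiring-^ (x + y) n ⟨
  (x + y) RS.^ n                   ≡⟨ Binomial.theorem n x y ⟩
  Binomial.binomialExpansion x y n ≡⟨ sum-cong-≗ {suc n} term ⟩
  sum {suc n} (t ∘ toℕ)            ≡⟨ Σ-as-sum (suc n) t ⟨
  Σ (suc n) t                      ∎
  where
  open ≡-Reasoning
  ^-as-semiring-^ : ∀ z m → z RS.^ m ≡ z ^ m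
  ^-as-semiring-^ z zero    = refl
  ^-as-semiring-^ z (suc m) = cong (z *_) (^-as-semiring-^ z m)
  ×-as-* : ∀ c z → c RS.× z ≡ + c * z
  ×-as-* zero    z = sym (ℤ.*-zeroˡ z)
  ×-as-* (suc c) z = trans (cong (_+_ z) (×-as-* c z))
                       (sym (trans (ℤ.*-distribʳ-+ z (+ 1) (+ c)) (cong (_+ (+ c * z)) (ℤ.*-identityˡ z))))
  t : ℕ → ℤ
  t k = + (n C k) * (x ^ k * y ^ (n ℕ.∸ k))
  term : ∀ k → Binomial.binomialTerm x y n k ≡ t (toℕ k)
  term k = trans (×-as-* (n C toℕ k) _)
             (cong (+ (n C toℕ k) *_) (cong₂ _*_ (^-as-semiring-^ x (toℕ k)) (^-as-semiring-^ y (n ℕ.∸ toℕ k))))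

prime∤! : ∀ {p m} → Prime p → m < p → ¬ p ∣ m ℕ.!
prime∤! {p} {zero}  p-prime _   = prime∤1 p-prime
prime∤! {p} {suc m} p-prime m<p p∣m! with euclidsLemma (suc m) (m ℕ.!) p-prime p∣m!
... | inj₁ p∣1+m = ℕ.<⇒≱ m<p (∣⇒≤ p∣1+m)
... | inj₂ p∣m!  = prime∤! p-prime (ℕ.<-trans (ℕ.n<1+n m) m<p) p∣m!

k![n∸k]!*nCk≡n! : ∀ {n k} → k ≤ n → k ℕ.! ℕ.* (n ℕ.∸ k) ℕ.! ℕ.* (n C k) ≡ n ℕ.!
k![n∸k]!*nCk≡n! {n} {k} k≤n =
  trans (cong (k ℕ.! ℕ.* (n ℕ.∸ k) ℕ.! ℕ.*_) (nCk≡n!/k![n-k]! k≤n))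
        (m*[n/m]≡n {{k ℕ.!* (n ℕ.∸ k) !≢0}} (k![n∸k]!∣n! k≤n))

[1+n]Cn≡1+n : ∀ n → suc n C n ≡ suc n
[1+n]Cn≡1+n n = trans (nCk≡nC[n∸k] (ℕ.n≤1+n n)) (trans (cong (suc n C_) (ℕ.m+n∸n≡m 1 n)) (nC1≡n (suc n)))

prime∣pCk : ∀ {p k} → Prime p → 0 < k → k < p → p ∣ p C k
prime∣pCk {suc p} {k} p-prime 0<k k<p
  with euclidsLemma (k ℕ.! ℕ.* (suc p ℕ.∸ k) ℕ.!) (suc p C k) p-prime
         (subst (suc p ∣_) (sym (k![n∸k]!*nCk≡n! (ℕ.<⇒≤ k<p))) (m∣m*n (p ℕ.!)))
... | inj₂ p∣pCk = p∣pCk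
... | inj₁ p∣k![p∸k]! with euclidsLemma (k ℕ.!) ((suc p ℕ.∸ k) ℕ.!) p-prime p∣k![p∸k]!
...   | inj₁ p∣k!     = ⊥-elim (prime∤! p-prime k<p p∣k!)
...   | inj₂ p∣[p∸k]! = ⊥-elim (prime∤! p-prime (ℕ.∸-monoʳ-< 0<k (ℕ.<⇒≤ k<p)) p∣[p∸k]!)

freshman's-dream : ∀ {p} → Prime p → ∀ x → (x + + 1) ^ p ≈ x ^ p + + 1 [mod p ]
freshman's-dream {suc p} p-prime x = begin
  (x + + 1) ^ suc p                    ≡⟨ binomial (suc p) x (+ 1) ⟩
  t 0 + Σ (suc p) (t ∘ suc)            ≡⟨ cong (_+_ (t 0)) (Σ-last p (t ∘ suc)) ⟩
  t 0 + (Σ p (t ∘ suc) + t (suc p))    ≈⟨ ≈-+ (≈-refl {a = t 0}) (≈-+ (Σ-≈0 p inner≈0) (≈-refl {a = t (suc p)})) ⟩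
  t 0 + (+ 0 + t (suc p))              ≡⟨ cong₂ (λ u v → u + (+ 0 + v)) first last ⟩
  + 1 + (+ 0 + x ^ suc p)              ≡⟨ rearrange (x ^ suc p) ⟩
  x ^ suc p + + 1                      ∎
  where
  open ≈-Reasoning (suc p)
  t : ℕ → ℤ
  t k = + (suc p C k) * (x ^ k * (+ 1) ^ (suc p ℕ.∸ k))
  inner≈0 : ∀ k → k < p → t (suc k) ≈ + 0 [mod suc p ]
  inner≈0 k k<p = ∣⇒*≈0 _ (prime∣pCk p-prime (s≤s z≤n) (s≤s k<p))
  first : t 0 ≡ + 1
  first = trans (ℤ.*-identityˡ _) (trans (ℤ.*-identityˡ _) (ℤ.^-zeroˡ (suc p)))
  last : t (suc p) ≡ x ^ suc p
  last = trans (cong₂ (λ c u → + c * (x ^ suc p * u)) (nCn≡1 (suc p)) (ℤ.^-zeroˡ (p ℕ.∸ p)))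
               (trans (ℤ.*-identityˡ _) (ℤ.*-identityʳ _))
  rearrange : ∀ y → + 1 + (+ 0 + y) ≡ y + + 1
  rearrange = solve-∀

fermat : ∀ {p} → Prime p → ∀ x → (+ x) ^ p ≈ + x [mod p ]
fermat {suc p} _       zero    = ≡⇒≈ (ℤ.*-zeroˡ ((+ 0) ^ p))
fermat {suc p} p-prime (suc x) = begin
  (+ 1 + + x) ^ suc p   ≡⟨ cong (_^ suc p) (ℤ.+-comm (+ 1) (+ x)) ⟩
  (+ x + + 1) ^ suc p   ≈⟨ freshman's-dream p-prime (+ x) ⟩
  (+ x) ^ suc p + + 1   ≈⟨ ≈-+ (fermat p-prime x) (≈-refl {a = + 1}) ⟩
  + x + + 1             ≡⟨ ℤ.+-comm (+ x) (+ 1) ⟩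
  + 1 + + x             ∎
  where open ≈-Reasoning (suc p)

fermat-^-shift : ∀ {p} → Prime p → ∀ x k m → 0 < k → (+ x) ^ (k ℕ.+ m ℕ.* (p ℕ.∸ 1)) ≈ (+ x) ^ k [mod p ]
fermat-^-shift {p} p-prime x k zero    _   = ≡⇒≈ (cong ((+ x) ^_) (ℕ.+-identityʳ k))
fermat-^-shift {suc p} p-prime x (suc k) (suc m) _ = begin
  (+ x) ^ (suc k ℕ.+ (p ℕ.+ m ℕ.* p))  ≡⟨ cong ((+ x) ^_) (sym (ℕ.+-assoc (suc k) p (m ℕ.* p))) ⟩
  (+ x) ^ (suc k ℕ.+ p ℕ.+ m ℕ.* p)    ≈⟨ fermat-^-shift p-prime x (suc k ℕ.+ p) m (s≤s z≤n) ⟩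
  (+ x) ^ (suc k ℕ.+ p)                ≡⟨ cong ((+ x) ^_) (sym (ℕ.+-suc k p)) ⟩
  (+ x) ^ (k ℕ.+ suc p)                ≡⟨ ℤ.^-distribˡ-+-* (+ x) k (suc p) ⟩
  (+ x) ^ k * (+ x) ^ suc p            ≈⟨ ≈-* (≈-refl {a = (+ x) ^ k}) (fermat p-prime x) ⟩
  (+ x) ^ k * + x                      ≡⟨ ℤ.*-comm ((+ x) ^ k) (+ x) ⟩
  (+ x) ^ suc k                        ∎
  where open ≈-Reasoning (suc p)

fermat-unit : ∀ {p a} → Prime p → ¬ a ≈ + 0 [mod p ] → a ^ (p ℕ.∸ 1) ≈ + 1 [mod p ]
fermat-unit {suc p} {a} p-prime a≉0 =
  [ (λ x≈0 → ⊥-elim (a≉0 (≈-trans (≈-%ℕ a) x≈0)))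
  , (λ x^p-1≈0 → ≈-trans (≈-^ p (≈-%ℕ a)) (a-b≈0⇒a≈b x^p-1≈0))
  ]′ (≈0-euclid p-prime x[x^p-1]≈0)
  where
  x : ℕ
  x = a %ℕ suc p
  x[x^p-1]≈0 : + x * ((+ x) ^ p - + 1) ≈ + 0 [mod suc p ]
  x[x^p-1]≈0 = ≈-trans (≡⇒≈ (expand (+ x) ((+ x) ^ p))) (a≈b⇒a-b≈0 (fermat p-prime x))
    where expand : ∀ a b → a * (b - + 1) ≡ a * b - a
          expand = solve-∀

fermat-∣ : ∀ {p a e} → Prime p → ¬ a ≈ + 0 [mod p ] → (p ℕ.∸ 1) ∣ e → a ^ e ≈ + 1 [mod p ]
fermat-∣ {p} {a} p-prime a≉0 (divides m refl) = begin
  a ^ (m ℕ.* (p ℕ.∸ 1))    ≡⟨ cong (a ^_) (ℕ.*-comm m (p ℕ.∸ 1)) ⟩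
  a ^ ((p ℕ.∸ 1) ℕ.* m)    ≡⟨ ℤ.^-*-assoc a (p ℕ.∸ 1) m ⟨
  (a ^ (p ℕ.∸ 1)) ^ m      ≈⟨ ≈-^ m (fermat-unit p-prime a≉0) ⟩
  (+ 1) ^ m                ≡⟨ ℤ.^-zeroˡ m ⟩
  + 1                      ∎
  where open ≈-Reasoning p

-- Power sums modulo a prime

powerSum : ℕ → ℕ → ℤ
powerSum n l = Σ n (λ j → (+ j) ^ l)

binomial-difference : ∀ l x → (x + + 1) ^ suc l - x ^ suc l ≡ Σ (suc l) (λ i → + (suc l C i) * x ^ i)
binomial-difference l x = begin
  (x + + 1) ^ suc l - x ^ suc l                ≡⟨ cong (_- x ^ suc l) (binomial (suc l) x (+ 1)) ⟩
  Σ (suc (suc l)) t - x ^ suc l                ≡⟨ cong (_- x ^ suc l) (Σ-last (suc l) t) ⟩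
  Σ (suc l) t + t (suc l) - x ^ suc l          ≡⟨ cong (λ z → Σ (suc l) t + z - x ^ suc l) last-term ⟩
  Σ (suc l) t + x ^ suc l - x ^ suc l          ≡⟨ cancel (Σ (suc l) t) (x ^ suc l) ⟩
  Σ (suc l) t                                  ≡⟨ Σ-cong (suc l) (λ i _ → cong (+ (suc l C i) *_) (drop-one i)) ⟩
  Σ (suc l) (λ i → + (suc l C i) * x ^ i)      ∎
  where
  open ≡-Reasoning
  t : ℕ → ℤ
  t i = + (suc l C i) * (x ^ i * (+ 1) ^ (suc l ℕ.∸ i))
  drop-one : ∀ i → x ^ i * (+ 1) ^ (suc l ℕ.∸ i) ≡ x ^ i
  drop-one i = trans (cong (x ^ i *_) (ℤ.^-zeroˡ (suc l ℕ.∸ i))) (ℤ.*-identityʳ (x ^ i))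
  last-term : t (suc l) ≡ x ^ suc l
  last-term = trans (cong₂ _*_ (cong +_ (nCn≡1 (suc l))) (drop-one (suc l))) (ℤ.*-identityˡ _)
  cancel : ∀ a b → a + b - b ≡ a
  cancel = solve-∀

powerSum-recurrence : ∀ n l → (+ n) ^ suc l ≡ Σ (suc l) (λ i → + (suc l C i) * powerSum n i)
powerSum-recurrence n l = begin
  (+ n) ^ suc l                                          ≡⟨ sym (ℤ.+-identityʳ _) ⟩
  g n - + 0                                              ≡⟨ cong (_-_ (g n)) (sym (ℤ.*-zeroˡ ((+ 0) ^ l))) ⟩
  g n - g 0                                              ≡⟨ Σ-telescope n g ⟨
  Σ n (λ a → g (suc a) - g a)                            ≡⟨ Σ-cong n (λ a _ → cong (λ z → z ^ suc l - g a) (ℤ.+-comm (+ 1) (+ a))) ⟩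
  Σ n (λ a → (+ a + + 1) ^ suc l - g a)                  ≡⟨ Σ-cong n (λ a _ → binomial-difference l (+ a)) ⟩
  Σ n (λ a → Σ (suc l) (λ i → c i * (+ a) ^ i))          ≡⟨ Σ-swap n (suc l) (λ a i → c i * (+ a) ^ i) ⟩
  Σ (suc l) (λ i → Σ n (λ a → c i * (+ a) ^ i))          ≡⟨ Σ-cong (suc l) (λ i _ → sym (*-distribˡ-Σ n (c i) (λ a → (+ a) ^ i))) ⟩
  Σ (suc l) (λ i → c i * powerSum n i)                   ∎
  where
  open ≡-Reasoning
  g : ℕ → ℤ
  g a = (+ a) ^ suc l
  c : ℕ → ℤ
  c i = + (suc l C i)

powerSum≈0 : ∀ {p} → Prime p → ∀ l → l < p ℕ.∸ 1 → powerSum p l ≈ + 0 [mod p ]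
powerSum≈0 {suc p} p-prime = <-rec _ step
  where
  step : ∀ l → (∀ {i} → i < l → i < p → powerSum (suc p) i ≈ + 0 [mod suc p ]) →
         l < p → powerSum (suc p) l ≈ + 0 [mod suc p ]
  step l ih l<p = [ ⊥-elim ∘ 1+l≉0 , id ]′ (≈0-euclid p-prime lth-term≈0)
    where
    c : ℕ → ℤ
    c i = + (suc l C i)
    lower-terms : ℤ
    lower-terms = Σ l (λ i → c i * powerSum (suc p) i)
    lower-terms≈0 : lower-terms ≈ + 0 [mod suc p ]
    lower-terms≈0 = Σ-≈0 l (λ i i<l → ≈0⇒*≈0 (c i) (ih i<l (ℕ.<-trans i<l l<p)))
    p^[1+l]≈0 : (+ suc p) ^ suc l ≈ + 0 [mod suc p ]
    p^[1+l]≈0 = ≈-trans (≡⇒≈ (ℤ.*-comm (+ suc p) _)) (multiple≈0 ((+ suc p) ^ l))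
    lth-term≈0 : c l * powerSum (suc p) l ≈ + 0 [mod suc p ]
    lth-term≈0 = ≈-trans (≡⇒≈ lth-term≡) (a≈b⇒a-b≈0 (≈-trans p^[1+l]≈0 (≈-sym lower-terms≈0)))
      where
      open ≡-Reasoning
      isolate : ∀ a b → b ≡ a + b - a
      isolate = solve-∀
      lth-term≡ : c l * powerSum (suc p) l ≡ (+ suc p) ^ suc l - lower-terms
      lth-term≡ = begin
        c l * powerSum (suc p) l                           ≡⟨ isolate lower-terms _ ⟩
        lower-terms + c l * powerSum (suc p) l - lower-terms ≡⟨ cong (_- lower-terms) (Σ-last l _) ⟨
        Σ (suc l) (λ i → c i * powerSum (suc p) i) - lower-terms ≡⟨ cong (_- lower-terms) (powerSum-recurrence (suc p) l) ⟨
        (+ suc p) ^ suc l - lower-terms                     ∎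
    1+l≉0 : ¬ c l ≈ + 0 [mod suc p ]
    1+l≉0 c≈0 = ℕ.<⇒≱ (s≤s l<p) (∣⇒≤ (subst (suc p ∣_) ([1+n]Cn≡1+n l) (≈0⇒∣ c≈0)))

affinePowerSum≈0 : ∀ {p} → Prime p → ∀ d → d < p ℕ.∸ 1 → ∀ a b → Σ p (λ j → (+ j * a + b) ^ d) ≈ + 0 [mod p ]
affinePowerSum≈0 {p} p-prime d d<p-1 a b = begin
  Σ p (λ j → (+ j * a + b) ^ d)                        ≡⟨ Σ-cong p (λ j _ → trans (binomial d (+ j * a) b)
                                                            (Σ-cong (suc d) (λ l _ → regroup j l))) ⟩
  Σ p (λ j → Σ (suc d) (λ l → coef l * (+ j) ^ l))     ≡⟨ Σ-swap p (suc d) (λ j l → coef l * (+ j) ^ l) ⟩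
  Σ (suc d) (λ l → Σ p (λ j → coef l * (+ j) ^ l))     ≡⟨ Σ-cong (suc d) (λ l _ → sym (*-distribˡ-Σ p (coef l) (λ j → (+ j) ^ l))) ⟩
  Σ (suc d) (λ l → coef l * powerSum p l)              ≈⟨ Σ-≈0 (suc d) (λ l l≤d → ≈0⇒*≈0 (coef l)
                                                            (powerSum≈0 p-prime l (ℕ.≤-<-trans (ℕ.≤-pred l≤d) d<p-1))) ⟩
  + 0                                                  ∎
  where
  open ≈-Reasoning p
  coef : ℕ → ℤ
  coef l = + (d C l) * (a ^ l * b ^ (d ℕ.∸ l))
  regroup : ∀ j l → + (d C l) * ((+ j * a) ^ l * b ^ (d ℕ.∸ l)) ≡ coef l * (+ j) ^ l
  regroup j l = trans (cong (λ z → + (d C l) * (z * b ^ (d ℕ.∸ l))) (^-distribʳ-* (+ j) a l))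
                      (shuffle (+ (d C l)) ((+ j) ^ l) (a ^ l) (b ^ (d ℕ.∸ l)))
    where shuffle : ∀ c x y z → c * (x * y * z) ≡ c * (y * z) * x
          shuffle = solve-∀

affinePowerSum≈0-∤ : ∀ {p e} → Prime p → 0 < e → ¬ (p ℕ.∸ 1) ∣ e →
                     ∀ a b → Σ p (λ j → (+ (j ℕ.* a ℕ.+ b)) ^ e) ≈ + 0 [mod p ]
affinePowerSum≈0-∤ {p} {e} p-prime 0<e p-1∤e a b with prime⇒2≤ p-prime
... | s≤s (s≤s {n = q} _) = begin
  Σ p (λ j → (+ (j ℕ.* a ℕ.+ b)) ^ e)          ≈⟨ Σ-cong-≈ p (λ j _ → reduce (j ℕ.* a ℕ.+ b)) ⟩
  Σ p (λ j → (+ (j ℕ.* a ℕ.+ b)) ^ d)          ≡⟨ Σ-cong p (λ j _ → cong (_^ d) (pos-*-+ j a b)) ⟩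
  Σ p (λ j → (+ j * + a + + b) ^ d)            ≈⟨ affinePowerSum≈0 p-prime d (m%n<n e (suc q)) (+ a) (+ b) ⟩
  + 0                                          ∎
  where
  open ≈-Reasoning p
  d : ℕ
  d = e % suc q
  0<d : 0 < d
  0<d with d in d≡
  ... | zero  = ⊥-elim (p-1∤e (divides (e / suc q) (trans (m≡m%n+[m/n]*n e (suc q)) (cong (ℕ._+ e / suc q ℕ.* suc q) d≡))))
  ... | suc _ = s≤s z≤n
  reduce : ∀ x → (+ x) ^ e ≈ (+ x) ^ d [mod p ]
  reduce x = ≈-trans (≡⇒≈ (cong ((+ x) ^_) (m≡m%n+[m/n]*n e (suc q)))) (fermat-^-shift p-prime x d (e / suc q) 0<d)

-- Units and Euler's totient

coprime-∣ˡ : ∀ {d k n} → d ∣ k → Coprime k n → Coprime d n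
coprime-∣ˡ d∣k k⊥n (e∣d , e∣n) = k⊥n (∣-trans e∣d d∣k , e∣n)

coprime-* : ∀ {k q r} → Coprime k q → Coprime k r → Coprime k (q ℕ.* r)
coprime-* k⊥q k⊥r (d∣k , d∣qr) = k⊥r (d∣k , coprime-divisor (coprime-∣ˡ d∣k k⊥q) d∣qr)

coprime-∣ʳ : ∀ {k d n} → d ∣ n → Coprime k n → Coprime k d
coprime-∣ʳ d∣n k⊥n (e∣k , e∣d) = k⊥n (e∣k , ∣-trans e∣d d∣n)

coprime-+-multiple : ∀ {i j n} → Coprime i n → Coprime (j ℕ.* n ℕ.+ i) n
coprime-+-multiple {j = j} i⊥n (d∣x , d∣n) = i⊥n (∣m+n∣m⇒∣n d∣x (∣n⇒∣m*n j d∣n) , d∣n)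

coprime-+-multiple⁻ : ∀ {i j n} → Coprime (j ℕ.* n ℕ.+ i) n → Coprime i n
coprime-+-multiple⁻ {j = j} x⊥n (d∣i , d∣n) = x⊥n (∣m∣n⇒∣m+n (∣n⇒∣m*n j d∣n) d∣i , d∣n)

coprime⇒*∣ : ∀ {m n o} → Coprime m n → m ∣ o → n ∣ o → m ℕ.* n ∣ o
coprime⇒*∣ {m} {n} m⊥n m∣o n∣o = subst (_∣ _) lcm≡m*n (lcm-least m∣o n∣o)
  where
  lcm≡m*n : lcm m n ≡ m ℕ.* n
  lcm≡m*n = trans (sym (ℕ.*-identityˡ (lcm m n))) (trans (cong (ℕ._* lcm m n) (sym (coprime⇒gcd≡1 m⊥n))) (gcd*lcm m n))

prime∣⇒¬coprime : ∀ {p x} → Prime p → p ∣ x → ¬ Coprime x p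
prime∣⇒¬coprime p-prime p∣x x⊥p = prime≢1 p-prime (x⊥p (p∣x , ∣-refl))

prime∤⇒coprime : ∀ {p x} → Prime p → ¬ p ∣ x → Coprime x p
prime∤⇒coprime p-prime p∤x (d∣x , d∣p) with prime⇒irreducible p-prime d∣p
... | inj₁ d≡1    = d≡1
... | inj₂ refl   = ⊥-elim (p∤x d∣x)

¬coprime⇒prime∣ : ∀ {p x} → Prime p → ¬ Coprime x p → p ∣ x
¬coprime⇒prime∣ {p} {x} p-prime x⊥̸p with p ∣? x
... | yes p∣x = p∣x
... | no  p∤x = ⊥-elim (x⊥̸p (prime∤⇒coprime p-prime p∤x))

-- Opaque so that unification never unfolds gcd.
opaque
  χ₀ : ℕ → ℕ → ℤ
  χ₀ n k = if gcd k n ≡ᵇ 1 then + 1 else + 0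

opaque
  unfolding χ₀
  χ₀-def : ∀ n k → χ₀ n k ≡ (if gcd k n ≡ᵇ 1 then + 1 else + 0)
  χ₀-def n k = refl

χ₀-elim : ∀ (P : ℤ → Set) n k → (Coprime k n → P (+ 1)) → (¬ Coprime k n → P (+ 0)) → P (χ₀ n k)
χ₀-elim P n k coprime-case other-case = subst P (sym (χ₀-def n k)) by-cases
  where
  by-cases : P (if gcd k n ≡ᵇ 1 then + 1 else + 0)
  by-cases with gcd k n ≡ᵇ 1 in gcd≡ᵇ1
  ... | true  = coprime-case (gcd≡1⇒coprime (ℕ.≡ᵇ⇒≡ (gcd k n) 1 (subst T (sym gcd≡ᵇ1) tt)))
  ... | false = other-case (λ k⊥n → subst T gcd≡ᵇ1 (ℕ.≡⇒≡ᵇ (gcd k n) 1 (coprime⇒gcd≡1 k⊥n)))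

χ₀-coprime : ∀ {n k} → Coprime k n → χ₀ n k ≡ + 1
χ₀-coprime {n} {k} k⊥n = χ₀-elim (_≡ + 1) n k (λ _ → refl) (λ k⊥̸n → ⊥-elim (k⊥̸n k⊥n))

χ₀-¬coprime : ∀ {n k} → ¬ Coprime k n → χ₀ n k ≡ + 0
χ₀-¬coprime {n} {k} k⊥̸n = χ₀-elim (_≡ + 0) n k (λ k⊥n → ⊥-elim (k⊥̸n k⊥n)) (λ _ → refl)

χ₀-cong : ∀ n m a b → (Coprime a n → Coprime b m) → (Coprime b m → Coprime a n) → χ₀ n a ≡ χ₀ m b
χ₀-cong n m a b to from =
  χ₀-elim (_≡ χ₀ m b) n a (λ a⊥n → sym (χ₀-coprime (to a⊥n))) (λ a⊥̸n → sym (χ₀-¬coprime (a⊥̸n ∘ from)))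

χ₀-periodic : ∀ n j i → χ₀ n (j ℕ.* n ℕ.+ i) ≡ χ₀ n i
χ₀-periodic n j i = χ₀-cong n n (j ℕ.* n ℕ.+ i) i (coprime-+-multiple⁻ {j = j}) (coprime-+-multiple {j = j})

χ₀-* : ∀ q r k → χ₀ (q ℕ.* r) k ≡ χ₀ r k * χ₀ q k
χ₀-* q r k = χ₀-elim (λ x → x ≡ χ₀ r k * χ₀ q k) (q ℕ.* r) k
  (λ k⊥qr → sym (cong₂ _*_ (χ₀-coprime (coprime-∣ʳ (n∣m*n q) k⊥qr)) (χ₀-coprime (coprime-∣ʳ (m∣m*n r) k⊥qr))))
  (λ k⊥̸qr → χ₀-elim (λ x → + 0 ≡ x * χ₀ q k) r k
    (λ k⊥r → sym (trans (ℤ.*-identityˡ _) (χ₀-¬coprime (λ k⊥q → k⊥̸qr (coprime-* k⊥q k⊥r)))))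
    (λ _ → refl))

unitPowerSum : ℕ → ℕ → ℤ
unitPowerSum n e = Σ n (λ k → χ₀ n k * (+ k) ^ e)

+sum-range1 : ∀ (g : ℕ → ℕ) m → + sumℕ (map g (range1 m)) ≡ Σ m (λ k → + g (suc k))
+sum-range1 g m = go id m
  where
  go : ∀ (f : ℕ → ℕ) m → + sumℕ (map g (map suc (applyUpTo f m))) ≡ Σ m (λ k → + g (suc (f k)))
  go f zero    = refl
  go f (suc m) = trans (ℤ.pos-+ (g (suc (f 0))) _) (cong (_+_ (+ g (suc (f 0)))) (go (f ∘ suc) m))

+-if-coprime : ∀ n k x → + (if gcd k n ≡ᵇ 1 then x else 0) ≡ χ₀ n k * + x
+-if-coprime n k x = trans (distribute (gcd k n ≡ᵇ 1)) (cong (_* + x) (sym (χ₀-def n k)))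
  where
  distribute : ∀ b → + (if b then x else 0) ≡ (if b then + 1 else + 0) * + x
  distribute true  = sym (ℤ.*-identityˡ (+ x))
  distribute false = refl

totient-as-Σ : ∀ n → + φ n ≡ Σ n (χ₀ n)
totient-as-Σ n = begin
  + φ n                              ≡⟨ +sum-range1 _ n ⟩
  Σ n (λ k → + g (suc k))            ≡⟨ Σ-cong n (λ k _ → trans (+-if-coprime n (suc k) 1) (ℤ.*-identityʳ _)) ⟩
  Σ n (χ₀ n ∘ suc)                   ≡⟨ Σ-rotate n (χ₀ n) (χ₀-cong n n n 0 (λ n⊥n (d∣0 , d∣n) → n⊥n (d∣n , d∣n))
                                                                      (λ 0⊥n (d∣n , _) → 0⊥n (_ ∣0 , d∣n))) ⟩
  Σ n (χ₀ n)                         ∎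
  where
  open ≡-Reasoning
  g : ℕ → ℕ
  g k = if gcd k n ≡ᵇ 1 then 1 else 0

S-as-unitPowerSum : ∀ {n} → 1 < n → + S n ≡ unitPowerSum n (n ℕ.∸ 1)
S-as-unitPowerSum {suc (suc m)} (s≤s (s≤s z≤n)) = begin
  + S n                              ≡⟨ +sum-range1 _ (suc m) ⟩
  Σ (suc m) (λ k → + g (suc k))      ≡⟨ Σ-cong (suc m) (λ k _ → trans (+-if-coprime n (suc k) _)
                                          (cong (χ₀ n (suc k) *_) (pos-^ (suc k) (suc m)))) ⟩
  Σ (suc m) (f ∘ suc)                ≡⟨ ℤ.+-identityˡ _ ⟨
  + 0 + Σ (suc m) (f ∘ suc)          ≡⟨ cong (_+ Σ (suc m) (f ∘ suc)) zeroth-term ⟨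
  unitPowerSum n (suc m)             ∎
  where
  open ≡-Reasoning
  n = suc (suc m)
  g : ℕ → ℕ
  g k = if gcd k n ≡ᵇ 1 then k ℕ.^ suc m else 0
  f : ℕ → ℤ
  f k = χ₀ n k * (+ k) ^ suc m
  zeroth-term : f 0 ≡ + 0
  zeroth-term = trans (cong (χ₀ n 0 *_) (ℤ.*-zeroˡ ((+ 0) ^ m))) (ℤ.*-zeroʳ (χ₀ n 0))

unitSum-blocks : ∀ q r (h : ℕ → ℤ) →
  Σ (q ℕ.* r) (λ k → χ₀ (q ℕ.* r) k * h k) ≡ Σ r (λ i → χ₀ r i * Σ q (λ j → χ₀ q (j ℕ.* r ℕ.+ i) * h (j ℕ.* r ℕ.+ i)))
unitSum-blocks q r h = begin
  Σ (q ℕ.* r) F                                            ≡⟨ Σ-blocks q r F ⟩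
  Σ q (λ j → Σ r (λ i → F (j ℕ.* r ℕ.+ i)))                ≡⟨ Σ-swap q r (λ j i → F (j ℕ.* r ℕ.+ i)) ⟩
  Σ r (λ i → Σ q (λ j → F (j ℕ.* r ℕ.+ i)))                ≡⟨ Σ-cong r (λ i _ → Σ-cong q (λ j _ → factor i j)) ⟩
  Σ r (λ i → Σ q (λ j → χ₀ r i * G i j))                   ≡⟨ Σ-cong r (λ i _ → sym (*-distribˡ-Σ q (χ₀ r i) (G i))) ⟩
  Σ r (λ i → χ₀ r i * Σ q (G i))                           ∎
  where
  open ≡-Reasoning
  F : ℕ → ℤ
  F k = χ₀ (q ℕ.* r) k * h k
  G : ℕ → ℕ → ℤ
  G i j = χ₀ q (j ℕ.* r ℕ.+ i) * h (j ℕ.* r ℕ.+ i)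
  factor : ∀ i j → F (j ℕ.* r ℕ.+ i) ≡ χ₀ r i * G i j
  factor i j = begin
    χ₀ (q ℕ.* r) x * h x      ≡⟨ cong (_* h x) (χ₀-* q r x) ⟩
    χ₀ r x * χ₀ q x * h x     ≡⟨ cong (λ c → c * χ₀ q x * h x) (χ₀-periodic r j i) ⟩
    χ₀ r i * χ₀ q x * h x     ≡⟨ ℤ.*-assoc (χ₀ r i) (χ₀ q x) (h x) ⟩
    χ₀ r i * G i j            ∎
    where x = j ℕ.* r ℕ.+ i

χ₀*x^e≈x^e : ∀ {p e} → Prime p → 0 < e → ∀ x → χ₀ p x * (+ x) ^ e ≈ (+ x) ^ e [mod p ]
χ₀*x^e≈x^e {p} {e} p-prime 0<e x = χ₀-elim (λ c → c * (+ x) ^ e ≈ (+ x) ^ e [mod p ]) p x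
  (λ _ → ≡⇒≈ (ℤ.*-identityˡ _))
  (λ x⊥̸p → ≈-trans (≡⇒≈ (ℤ.*-zeroˡ ((+ x) ^ e))) (≈-sym (∣⇒^≈0 (¬coprime⇒prime∣ p-prime x⊥̸p) 0<e)))

unitPowerSum≈0 : ∀ {p n e} → Prime p → p ∣ n → 0 < e → ¬ (p ℕ.∸ 1) ∣ e → unitPowerSum n e ≈ + 0 [mod p ]
unitPowerSum≈0 {p} {_} {e} p-prime (divides r refl) 0<e p-1∤e =
  subst (λ n → unitPowerSum n e ≈ + 0 [mod p ]) (ℕ.*-comm p r) (begin
    unitPowerSum (p ℕ.* r) e                                       ≡⟨ unitSum-blocks p r (λ k → (+ k) ^ e) ⟩
    Σ r (λ i → χ₀ r i * Σ p (λ j → χ₀ p (x i j) * (+ x i j) ^ e)) ≈⟨ Σ-≈0 r (λ i _ → ≈0⇒*≈0 (χ₀ r i) (column≈0 i)) ⟩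
    + 0                                                           ∎)
  where
  open ≈-Reasoning p
  x : ℕ → ℕ → ℕ
  x i j = j ℕ.* r ℕ.+ i
  column≈0 : ∀ i → Σ p (λ j → χ₀ p (x i j) * (+ x i j) ^ e) ≈ + 0 [mod p ]
  column≈0 i = ≈-trans (Σ-cong-≈ p (λ j _ → χ₀*x^e≈x^e p-prime 0<e (x i j)))
                       (affinePowerSum≈0-∤ p-prime 0<e p-1∤e r i)

unitPowerSum≈totient : ∀ {p n e} → Prime p → p ∣ n → (p ℕ.∸ 1) ∣ e → unitPowerSum n e ≈ + φ n [mod p ]
unitPowerSum≈totient {p} {n} {e} p-prime p∣n p-1∣e =
  ≈-trans (Σ-cong-≈ n (λ k _ → term k)) (≡⇒≈ (sym (totient-as-Σ n)))
  where
  term : ∀ k → χ₀ n k * (+ k) ^ e ≈ χ₀ n k [mod p ]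
  term k = χ₀-elim (λ c → c * (+ k) ^ e ≈ c [mod p ]) n k
    (λ k⊥n → ≈-trans (≡⇒≈ (ℤ.*-identityˡ _)) (fermat-∣ p-prime (λ k≈0 →
      prime∣⇒¬coprime p-prime (≈0⇒∣ k≈0) (coprime-∣ʳ p∣n k⊥n)) p-1∣e))
    (λ _ → ≈-refl)

module _ {q r : ℕ} (q-prime : Prime q) (q∤r : ¬ q ∣ r) (i : ℕ) where

  private
    r≉0 : ¬ + r ≈ + 0 [mod q ]
    r≉0 = q∤r ∘ ≈0⇒∣

  linearRoot-unique : ∀ {j j′} → j < q → j′ < q → q ∣ j ℕ.* r ℕ.+ i → q ∣ j′ ℕ.* r ℕ.+ i → j ≡ j′
  linearRoot-unique {j} {j′} j<q j′<q q∣x q∣x′ = ≈-small j<q j′<q (≈-*-cancelʳ q-prime r≉0 (≈-+-cancelʳ (+ i) (begin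
    + j * + r + + i           ≡⟨ pos-*-+ j r i ⟨
    + (j ℕ.* r ℕ.+ i)         ≈⟨ ∣⇒≈0 q∣x ⟩
    + 0                       ≈⟨ ∣⇒≈0 q∣x′ ⟨
    + (j′ ℕ.* r ℕ.+ i)        ≡⟨ pos-*-+ j′ r i ⟩
    + j′ * + r + + i          ∎)))
    where open ≈-Reasoning q

  linearRoot : ∃[ j₀ ] j₀ < q × q ∣ j₀ ℕ.* r ℕ.+ i
  linearRoot = j₀ , n%ℕd<d (- (s * + i)) q , ≈0⇒∣ root≈0
    where
    instance _ = prime⇒nonZero q-prime
    open ≈-Reasoning q
    -- an inverse of r modulo q, by Fermat
    s : ℤ
    s = (+ r) ^ (q ℕ.∸ 2)
    s*r≈1 : s * + r ≈ + 1 [mod q ]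
    s*r≈1 = ≈-trans (≡⇒≈ (trans (ℤ.*-comm s (+ r)) (cong ((+ r) ^_) (sym (ℕ.+-∸-assoc 1 (prime⇒2≤ q-prime))))))
                    (fermat-unit q-prime r≉0)
    j₀ : ℕ
    j₀ = (- (s * + i)) %ℕ q
    root≈0 : + (j₀ ℕ.* r ℕ.+ i) ≈ + 0 [mod q ]
    root≈0 = begin
      + (j₀ ℕ.* r ℕ.+ i)          ≡⟨ pos-*-+ j₀ r i ⟩
      + j₀ * + r + + i            ≈⟨ ≈-+ (≈-* (≈-sym (≈-%ℕ (- (s * + i)))) (≈-refl {a = + r})) (≈-refl {a = + i}) ⟩
      - (s * + i) * + r + + i     ≡⟨ regroup s (+ i) (+ r) ⟩
      - + i * (s * + r) + + i     ≈⟨ ≈-+ (≈-* (≈-refl {a = - + i}) s*r≈1) (≈-refl {a = + i}) ⟩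
      - + i * + 1 + + i           ≡⟨ cancel (+ i) ⟩
      + 0                         ∎
      where
      regroup : ∀ s i r → - (s * i) * r + i ≡ - i * (s * r) + i
      regroup = solve-∀
      cancel : ∀ i → - i * + 1 + i ≡ + 0
      cancel = solve-∀

Σχ₀-progression : ∀ {q r} → Prime q → ¬ q ∣ r → ∀ i → Σ q (λ j → χ₀ q (j ℕ.* r ℕ.+ i)) ≡ + (q ℕ.∸ 1)
Σχ₀-progression {q} {r} q-prime q∤r i =
  let (j₀ , j₀<q , q∣root) = linearRoot q-prime q∤r i in
  Σ-punctured q j₀ (λ j → χ₀ q (j ℕ.* r ℕ.+ i)) j₀<q
    (χ₀-¬coprime (prime∣⇒¬coprime q-prime q∣root))
    (λ j j<q j≢j₀ → χ₀-coprime (prime∤⇒coprime q-prime λ q∣x →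
      j≢j₀ (linearRoot-unique q-prime q∤r i j<q j₀<q q∣x q∣root)))

totient-prime-* : ∀ {q r} → Prime q → ¬ q ∣ r → φ (q ℕ.* r) ≡ (q ℕ.∸ 1) ℕ.* φ r
totient-prime-* {q} {r} q-prime q∤r = ℤ.+-injective (begin
  + φ (q ℕ.* r)                                                   ≡⟨ totient-as-Σ (q ℕ.* r) ⟩
  Σ (q ℕ.* r) (χ₀ (q ℕ.* r))                                      ≡⟨ Σ-cong (q ℕ.* r) (λ k _ → sym (ℤ.*-identityʳ _)) ⟩
  Σ (q ℕ.* r) (λ k → χ₀ (q ℕ.* r) k * + 1)                        ≡⟨ unitSum-blocks q r (λ _ → + 1) ⟩
  Σ r (λ i → χ₀ r i * Σ q (λ j → χ₀ q (j ℕ.* r ℕ.+ i) * + 1))     ≡⟨ Σ-cong r (λ i _ → cong (χ₀ r i *_) column) ⟩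
  Σ r (λ i → χ₀ r i * + (q ℕ.∸ 1))                                ≡⟨ Σ-cong r (λ i _ → ℤ.*-comm (χ₀ r i) _) ⟩
  Σ r (λ i → + (q ℕ.∸ 1) * χ₀ r i)                                ≡⟨ *-distribˡ-Σ r (+ (q ℕ.∸ 1)) (χ₀ r) ⟨
  + (q ℕ.∸ 1) * Σ r (χ₀ r)                                        ≡⟨ cong (+ (q ℕ.∸ 1) *_) (totient-as-Σ r) ⟨
  + (q ℕ.∸ 1) * + φ r                                             ≡⟨ ℤ.pos-* (q ℕ.∸ 1) (φ r) ⟨
  + ((q ℕ.∸ 1) ℕ.* φ r)                                           ∎)
  where
  open ≡-Reasoning
  column : ∀ {i} → Σ q (λ j → χ₀ q (j ℕ.* r ℕ.+ i) * + 1) ≡ + (q ℕ.∸ 1)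
  column {i} = trans (Σ-cong q (λ j _ → ℤ.*-identityʳ _)) (Σχ₀-progression q-prime q∤r i)

totient< : ∀ {n} → 1 < n → φ n < n
totient< {suc m} 1<n = s≤s (ℤ.drop‿+≤+ (begin
  + φ (suc m)                          ≡⟨ totient-as-Σ (suc m) ⟩
  χ₀ (suc m) 0 + Σ m (χ₀ (suc m) ∘ suc) ≡⟨ cong (_+ Σ m (χ₀ (suc m) ∘ suc)) (χ₀-¬coprime 0⊥̸n) ⟩
  + 0 + Σ m (χ₀ (suc m) ∘ suc)         ≤⟨ ℤ.+-monoʳ-≤ (+ 0) (Σ≤n m _ χ₀≤1) ⟩
  + 0 + + m                            ∎))
  where
  open ℤ.≤-Reasoning
  χ₀≤1 : ∀ k → χ₀ (suc m) (suc k) ℤ.≤ + 1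
  χ₀≤1 k = χ₀-elim (ℤ._≤ + 1) (suc m) (suc k) (λ _ → ℤ.≤-refl) (λ _ → ℤ.+≤+ z≤n)
  0⊥̸n : ¬ Coprime 0 (suc m)
  0⊥̸n 0⊥n = ℕ.<-irrefl (sym (0⊥n (_ ∣0 , ∣-refl))) 1<n

-- Squarefree numbers and Korselt's criterion

SquareFree : ℕ → Set
SquareFree n = ∀ p → Prime p → ¬ p ℕ.* p ∣ n

squareFree? : ∀ n → 0 < n → SquareFree n ⊎ ∃[ p ] Prime p × p ℕ.* p ∣ n
squareFree? n 0<n with ℕ.anyUpTo? (λ p → prime? p ×-dec (p ℕ.* p) ∣? n) (suc n)
... | yes (p , _ , p-prime , p²∣n) = inj₂ (p , p-prime , p²∣n)
... | no  none = inj₁ λ p p-prime p²∣n → none (p , s≤s (p≤n p-prime p²∣n) , p-prime , p²∣n)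
  where
  p≤n : ∀ {p} → Prime p → p ℕ.* p ∣ n → p ≤ n
  p≤n {p} p-prime p²∣n = ℕ.≤-trans (ℕ.m≤m*n p p {{prime⇒nonZero p-prime}}) (∣⇒≤ {{ℕ.>-nonZero 0<n}} p²∣n)

squareFree-∣ : ∀ {m n} → m ∣ n → SquareFree n → SquareFree m
squareFree-∣ m∣n sf p p-prime p²∣m = sf p p-prime (∣-trans p²∣m m∣n)

squareFree⇒∤cofactor : ∀ {p r} → Prime p → SquareFree (p ℕ.* r) → ¬ p ∣ r
squareFree⇒∤cofactor {p} p-prime sf p∣r = sf p p-prime (*-monoʳ-∣ p p∣r)

primeFactor : ∀ {n} → 1 < n → ∃[ p ] Prime p × p ∣ n
primeFactor {n} 1<n with factorise n {{ℕ.>-nonZero (ℕ.m<n⇒0<n 1<n)}}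
... | record { factors = [] ; isFactorisation = n≡1 } = ⊥-elim (ℕ.<-irrefl (sym n≡1) 1<n)
... | record { factors = p ∷ ps ; isFactorisation = n≡p*ps ; factorsPrime = p-prime ∷ _ } =
  p , p-prime , subst (p ∣_) (sym n≡p*ps) (m∣m*n (product ps))

squareFree-rec : ∀ (P : ℕ → Set) → P 1 → (∀ {q r} → Prime q → ¬ q ∣ r → P r → P (q ℕ.* r)) →
                 ∀ {n} → 0 < n → SquareFree n → P n
squareFree-rec P base step {n} 0<n sf = go n (<-wellFounded n) 0<n sf
  where
  go : ∀ n → Acc _<_ n → 0 < n → SquareFree n → P n
  go (suc zero)    _        _ _  = base
  go (suc (suc m)) (acc rs) _ sf with primeFactor {suc (suc m)} (s≤s (s≤s z≤n))
  ... | q , q-prime , divides r n≡r*q = subst P (sym n≡q*r) (step q-prime q∤r (go r (rs r<n) 0<r (squareFree-∣ r∣n sf)))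
    where
    n≡q*r : suc (suc m) ≡ q ℕ.* r
    n≡q*r = trans n≡r*q (ℕ.*-comm r q)
    r∣n : r ∣ suc (suc m)
    r∣n = divides q n≡q*r
    0<r : 0 < r
    0<r = ℕ.n≢0⇒n>0 (λ r≡0 → ℕ.1+n≢0 (trans n≡r*q (cong (ℕ._* q) r≡0)))
    r<n : r < suc (suc m)
    r<n = subst (r <_) (sym n≡r*q) (ℕ.m<m*n r q {{ℕ.>-nonZero 0<r}} (prime⇒2≤ q-prime))
    q∤r : ¬ q ∣ r
    q∤r = squareFree⇒∤cofactor q-prime (subst SquareFree n≡q*r sf)

squareFree-≈0 : ∀ {n x} → 0 < n → SquareFree n → (∀ p → Prime p → p ∣ n → x ≈ + 0 [mod p ]) → x ≈ + 0 [mod n ]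
squareFree-≈0 {x = x} = squareFree-rec (λ n → (∀ p → Prime p → p ∣ n → x ≈ + 0 [mod p ]) → x ≈ + 0 [mod n ])
  (λ _ → ∣⇒≈0 (1∣ _))
  (λ {q} {r} q-prime q∤r ih x≈0 → ∣⇒≈0 (coprime⇒*∣ (Cop.sym (prime∤⇒coprime q-prime q∤r))
     (≈0⇒∣ (x≈0 q q-prime (m∣m*n r)))
     (≈0⇒∣ (ih (λ p p-prime p∣r → x≈0 p p-prime (∣-trans p∣r (n∣m*n q)))))))

prime∣totient⇒∣pred-factor : ∀ {n p} → 0 < n → SquareFree n → Prime p → p ∣ φ n →
                             ∃[ q ] Prime q × q ∣ n × p ∣ (q ℕ.∸ 1)
prime∣totient⇒∣pred-factor {p = p} 0<n sf p-prime =
  squareFree-rec (λ n → p ∣ φ n → ∃[ q ] Prime q × q ∣ n × p ∣ (q ℕ.∸ 1))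
  (⊥-elim ∘ prime∤1 p-prime)
  (λ {q} {r} q-prime q∤r ih p∣φqr →
     [ (λ p∣q-1 → q , q-prime , m∣m*n r , p∣q-1)
     , (λ p∣φr → let (q′ , q′-prime , q′∣r , p∣q′-1) = ih p∣φr
                 in q′ , q′-prime , ∣-trans q′∣r (n∣m*n q) , p∣q′-1)
     ]′ (euclidsLemma (q ℕ.∸ 1) (φ r) p-prime (subst (p ∣_) (totient-prime-* q-prime q∤r) p∣φqr)))
  0<n sf

pred∣totient : ∀ {n p} → SquareFree n → Prime p → p ∣ n → (p ℕ.∸ 1) ∣ φ n
pred∣totient {p = p} sf p-prime (divides r refl) =
  subst (λ m → (p ℕ.∸ 1) ∣ φ m) (ℕ.*-comm p r)
    (subst ((p ℕ.∸ 1) ∣_) (sym (totient-prime-* p-prime (squareFree⇒∤cofactor p-prime (subst SquareFree (ℕ.*-comm r p) sf))))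
      (m∣m*n (φ r)))

Korselt : ℕ → Set
Korselt n = ∀ p → Prime p → p ∣ n → (p ℕ.∸ 1) ∣ (n ℕ.∸ 1)

korselt⇒fermat-congruence : ∀ {n} → 0 < n → SquareFree n → Korselt n →
                            ∀ a → gcd (ℤ.∣ a ∣) n ≡ 1 → a ^ (n ℕ.∸ 1) ≈ + 1 [mod n ]
korselt⇒fermat-congruence 0<n sf korselt-n a gcd≡1 = a-b≈0⇒a≈b (squareFree-≈0 0<n sf λ p p-prime p∣n →
  a≈b⇒a-b≈0 (fermat-∣ p-prime (λ a≈0 → prime∣⇒¬coprime p-prime (≈0⇒∣ a≈0)
    (coprime-∣ʳ p∣n (gcd≡1⇒coprime gcd≡1))) (korselt-n p p-prime p∣n)))

binomial-nilpotent : ∀ {n t} → t * t ≈ + 0 [mod n ] → ∀ k → (+ 1 + t) ^ k ≈ + 1 + + k * t [mod n ]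
binomial-nilpotent {n} {t} t²≈0 zero    = ≡⇒≈ (sym (cong (_+_ (+ 1)) (ℤ.*-zeroˡ t)))
binomial-nilpotent {n} {t} t²≈0 (suc k) = begin
  (+ 1 + t) * (+ 1 + t) ^ k                 ≈⟨ ≈-* (≈-refl {a = + 1 + t}) (binomial-nilpotent t²≈0 k) ⟩
  (+ 1 + t) * (+ 1 + + k * t)               ≡⟨ expand t (+ k) ⟩
  + 1 + (+ 1 + + k) * t + + k * (t * t)     ≈⟨ ≈-+ (≈-refl {a = + 1 + (+ 1 + + k) * t}) (≈0⇒*≈0 (+ k) t²≈0) ⟩
  + 1 + (+ 1 + + k) * t + + 0               ≡⟨ ℤ.+-identityʳ _ ⟩
  + 1 + (+ 1 + + k) * t                     ∎
  where
  open ≈-Reasoning n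
  expand : ∀ t k → (+ 1 + t) * (+ 1 + k * t) ≡ + 1 + (+ 1 + k) * t + k * (t * t)
  expand = solve-∀

carmichael⇒squareFree : ∀ {n} → 0 < n →
                        (∀ (a : ℤ) → gcd (ℤ.∣ a ∣) n ≡ 1 → (a ^ (n ℕ.∸ 1)) ≡ + 1 [mod n ]) → SquareFree n
carmichael⇒squareFree {suc m} _ carmichael p p-prime (divides u n≡u*p*p) = ℕ.<⇒≱ t<n (∣⇒≤ {{ℕ.>-nonZero 0<t}} n∣t)
  where
  n = suc m
  t = p ℕ.* u
  n≡p*t : n ≡ p ℕ.* t
  n≡p*t = trans n≡u*p*p (rearrange u p)
    where rearrange : ∀ u p → u ℕ.* (p ℕ.* p) ≡ p ℕ.* (p ℕ.* u)
          rearrange = ℕ-Solver.solve-∀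
  0<t : 0 < t
  0<t = ℕ.n≢0⇒n>0 λ t≡0 → ℕ.1+n≢0 (trans n≡p*t (trans (cong (p ℕ.*_) t≡0) (ℕ.*-zeroʳ p)))
  t<n : t < n
  t<n = subst (t <_) (trans (ℕ.*-comm t p) (sym n≡p*t)) (ℕ.m<m*n t p {{ℕ.>-nonZero 0<t}} (prime⇒2≤ p-prime))
  1+t⊥n : Coprime (suc t) n
  1+t⊥n {d} (d∣1+t , d∣n) = ∣1⇒≡1 (∣m+n∣m⇒∣n (subst (d ∣_) (ℕ.+-comm 1 t) d∣1+t) (∣-trans d∣p (m∣m*n u)))
    where
    d∣p : d ∣ p
    d∣p = ∣m+n∣m⇒∣n (subst (d ∣_) (trans (ℕ.*-suc p t) (ℕ.+-comm p (p ℕ.* t))) (∣-trans d∣1+t (n∣m*n p)))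
                     (subst (d ∣_) n≡p*t d∣n)
  t²≈0 : + t * + t ≈ + 0 [mod n ]
  t²≈0 = ≈-trans (≡⇒≈ (trans (sym (ℤ.pos-* t t)) (cong +_ t*t≡u*n))) (≈-trans (≡⇒≈ (ℤ.pos-* u n)) (multiple≈0 (+ u)))
    where
    t*t≡u*n : t ℕ.* t ≡ u ℕ.* n
    t*t≡u*n = trans (rearrange p u) (cong (u ℕ.*_) (sym n≡u*p*p))
      where rearrange : ∀ p u → p ℕ.* u ℕ.* (p ℕ.* u) ≡ u ℕ.* (u ℕ.* (p ℕ.* p))
            rearrange = ℕ-Solver.solve-∀
  m*t≈0 : + m * + t ≈ + 0 [mod n ]
  m*t≈0 = ≈-+-cancelʳ (+ 1) (begin
    + m * + t + + 1         ≡⟨ ℤ.+-comm (+ m * + t) (+ 1) ⟩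
    + 1 + + m * + t         ≈⟨ binomial-nilpotent t²≈0 m ⟨
    (+ 1 + + t) ^ m         ≈⟨ ≡[mod]⇒≈ (carmichael (+ suc t) (coprime⇒gcd≡1 1+t⊥n)) ⟩
    + 1                     ≡⟨ ℤ.+-identityˡ (+ 1) ⟨
    + 0 + + 1               ∎)
    where open ≈-Reasoning n
  n∣t : n ∣ t
  n∣t = ≈0⇒∣ (begin
    + t                          ≡⟨ difference (+ t) (+ m) ⟩
    + t * + n - + m * + t        ≈⟨ a≈b⇒a-b≈0 (≈-trans (multiple≈0 (+ t)) (≈-sym m*t≈0)) ⟩
    + 0                          ∎)
    where
    open ≈-Reasoning n
    difference : ∀ t m → t ≡ t * (+ 1 + m) - m * t
    difference = solve-∀

-- The Möbius function

μ-factor : ℕ → ℕ → ℤ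
μ-factor n p = if ⌊ prime? p ⌋
               then (if ⌊ (p ℕ.* p) ∣? n ⌋ then + 0
                     else (if ⌊ p ∣? n ⌋ then - (+ 1) else + 1))
               else + 1

μ≡product : ∀ n → μ n ≡ foldr _*_ (+ 1) (map (μ-factor n) (range1 n))
μ≡product n = refl

∣product∣≡1 : ∀ (f : ℕ → ℤ) xs → (∀ x → ℤ.∣ f x ∣ ≡ 1) → ℤ.∣ foldr _*_ (+ 1) (map f xs) ∣ ≡ 1
∣product∣≡1 f []       _        = refl
∣product∣≡1 f (x ∷ xs) ∣f∣≡1 = trans (ℤ.abs-* (f x) _) (cong₂ ℕ._*_ (∣f∣≡1 x) (∣product∣≡1 f xs ∣f∣≡1))

product≡0 : ∀ (f : ℕ → ℤ) {x xs} → x ∈ xs → f x ≡ + 0 → foldr _*_ (+ 1) (map f xs) ≡ + 0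
product≡0 f {xs = _ ∷ ys} (here refl) fx≡0 = trans (cong (_* rest) fx≡0) (ℤ.*-zeroˡ rest)
  where rest = foldr _*_ (+ 1) (map f ys)
product≡0 f {xs = y ∷ _} (there x∈xs) fx≡0 = trans (cong (f y *_) (product≡0 f x∈xs fx≡0)) (ℤ.*-zeroʳ (f y))

∣μ∣≡1 : ∀ {n} → SquareFree n → ℤ.∣ μ n ∣ ≡ 1
∣μ∣≡1 {n} sf = ∣product∣≡1 (μ-factor n) (range1 n) ∣factor∣≡1
  where
  ∣factor∣≡1 : ∀ p → ℤ.∣ μ-factor n p ∣ ≡ 1
  ∣factor∣≡1 p with prime? p
  ... | no  _       = refl
  ... | yes p-prime with (p ℕ.* p) ∣? n
  ...   | yes p²∣n = ⊥-elim (sf p p-prime p²∣n)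
  ...   | no  _ with p ∣? n
  ...     | yes _ = refl
  ...     | no  _ = refl

μ≡0 : ∀ {n p} → 0 < n → Prime p → p ℕ.* p ∣ n → μ n ≡ + 0
μ≡0 {n} {suc p} 0<n p-prime p²∣n = product≡0 (μ-factor n) (∈-map⁺ suc (∈-upTo⁺ p<n)) factor≡0
  where
  p<n : p < n
  p<n = ℕ.≤-trans (ℕ.m≤m*n (suc p) (suc p)) (∣⇒≤ {{ℕ.>-nonZero 0<n}} p²∣n)
  factor≡0 : μ-factor n (suc p) ≡ + 0
  factor≡0 with prime? (suc p) | (suc p ℕ.* suc p) ∣? n
  ... | yes _ | yes _    = refl
  ... | no  ¬p-prime | _ = ⊥-elim (¬p-prime p-prime)
  ... | yes _ | no p²∤n  = ⊥-elim (p²∤n p²∣n)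

-- Weak Carmichael numbers

∣i∣≡1⇒i≡±1 : ∀ i → ℤ.∣ i ∣ ≡ 1 → i ≡ + 1 ⊎ i ≡ - + 1
∣i∣≡1⇒i≡±1 (+ _)      refl = inj₁ refl
∣i∣≡1⇒i≡±1 -[1+ _ ]   refl = inj₂ refl

x+unit≈0⇒x∣pred : ∀ {n x u} → 1 < n → x < n → ℤ.∣ u ∣ ≡ 1 → + x + u ≈ + 0 [mod n ] → x ∣ n ℕ.∸ 1
x+unit≈0⇒x∣pred {n} {x} {u} 1<n x<n ∣u∣≡1 x+u≈0 with ∣i∣≡1⇒i≡±1 u ∣u∣≡1
x+unit≈0⇒x∣pred {n} {x}     1<n x<n _ x+1≈0 | inj₁ refl = subst (λ m → x ∣ m ℕ.∸ 1) 1+x≡n ∣-refl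
  where
  n∣1+x : n ∣ suc x
  n∣1+x = subst (n ∣_) (ℕ.+-comm x 1) (≈0⇒∣ x+1≈0)
  1+x≡n : suc x ≡ n
  1+x≡n = ℕ.≤-antisym x<n (∣⇒≤ n∣1+x)
x+unit≈0⇒x∣pred {n} {zero}  1<n _   _ x-1≈0 | inj₂ refl = ⊥-elim (ℕ.<-irrefl (sym (∣1⇒≡1 (≈0⇒∣ x-1≈0))) 1<n)
x+unit≈0⇒x∣pred {n} {suc y} 1<n x<n _ x-1≈0 | inj₂ refl =
  subst (_∣ n ℕ.∸ 1) (cong suc (sym (∣∧<⇒≡0 (≈0⇒∣ x-1≈0) (ℕ.<-trans (ℕ.n<1+n y) x<n)))) (1∣ _)

S≈0 : ∀ {n p} → 1 < n → Prime p → p ∣ n → ¬ (p ℕ.∸ 1) ∣ (n ℕ.∸ 1) → + S n ≈ + 0 [mod p ]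
S≈0 1<n p-prime p∣n p-1∤n-1 =
  ≈-trans (≡⇒≈ (S-as-unitPowerSum 1<n)) (unitPowerSum≈0 p-prime p∣n (ℕ.m<n⇒0<n∸m 1<n) p-1∤n-1)

S≈totient : ∀ {n p} → 1 < n → Prime p → p ∣ n → (p ℕ.∸ 1) ∣ (n ℕ.∸ 1) → + S n ≈ + φ n [mod p ]
S≈totient 1<n p-prime p∣n p-1∣n-1 =
  ≈-trans (≡⇒≈ (S-as-unitPowerSum 1<n)) (unitPowerSum≈totient p-prime p∣n p-1∣n-1)

weakCarmichael⇒korselt : ∀ {n} → 1 < n → SquareFree n → + S n ≈ + φ n [mod n ] → Korselt n
weakCarmichael⇒korselt {n} 1<n sf S≈φ p p-prime p∣n = go p-prime p∣n (<-wellFounded (n ℕ.∸ p))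
  where
  0<n : 0 < n
  0<n = ℕ.m<n⇒0<n 1<n
  go : ∀ {p} → Prime p → p ∣ n → Acc _<_ (n ℕ.∸ p) → (p ℕ.∸ 1) ∣ (n ℕ.∸ 1)
  go {p} p-prime p∣n (acc rs) with (p ℕ.∸ 1) ∣? (n ℕ.∸ 1)
  ... | yes p-1∣n-1 = p-1∣n-1
  ... | no  p-1∤n-1 =
    let p∣φ = ≈0⇒∣ (≈-trans (≈-sym (≈-resp-∣ p∣n S≈φ)) (S≈0 1<n p-prime p∣n p-1∤n-1))
        (q , q-prime , q∣n , p∣q-1) = prime∣totient⇒∣pred-factor 0<n sf p-prime p∣φ
        q-1∣n-1 = go q-prime q∣n (rs (ℕ.∸-monoʳ-< (∣pred⇒< q-prime p∣q-1) (∣⇒≤ {{ℕ.>-nonZero 0<n}} q∣n)))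
    in ⊥-elim (prime≢1 p-prime (∣∧∣pred⇒≡1 0<n p∣n (∣-trans p∣q-1 q-1∣n-1)))

squareFree⇒S≉φ+μ : ∀ {n} → 1 < n → SquareFree n → ¬ + S n ≈ + φ n + μ n [mod n ]
squareFree⇒S≉φ+μ {n} 1<n sf S≈φ+μ
  with ℕ.anyUpTo? (λ p → prime? p ×-dec p ∣? n ×-dec (p ℕ.∸ 1) ∣? (n ℕ.∸ 1)) (suc n)
... | yes (p , _ , p-prime , p∣n , p-1∣n-1) = prime∤1 p-prime (subst (p ∣_) (∣μ∣≡1 sf) (≈0⇒∣ μ≈0))
  where
  μ≈0 : μ n ≈ + 0 [mod p ]
  μ≈0 = ≈-+-cancelʳ (+ φ n) (begin
    μ n + + φ n           ≡⟨ ℤ.+-comm (μ n) (+ φ n) ⟩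
    + φ n + μ n           ≈⟨ ≈-resp-∣ p∣n S≈φ+μ ⟨
    + S n                 ≈⟨ S≈totient 1<n p-prime p∣n p-1∣n-1 ⟩
    + φ n                 ≡⟨ ℤ.+-identityˡ (+ φ n) ⟨
    + 0 + + φ n           ∎)
    where open ≈-Reasoning p
... | no  no-korselt-prime =
  let (p , p-prime , p∣n) = primeFactor 1<n in
  no-korselt-prime (p , s≤s (∣⇒≤ p∣n) , p-prime , p∣n , korselt-n p p-prime p∣n)
  where
  instance _ = ℕ.>-nonZero (ℕ.m<n⇒0<n 1<n)
  S≈0[mod-n] : + S n ≈ + 0 [mod n ]
  S≈0[mod-n] = squareFree-≈0 (ℕ.m<n⇒0<n 1<n) sf λ q q-prime q∣n →
    S≈0 1<n q-prime q∣n (λ q-1∣n-1 → no-korselt-prime (q , s≤s (∣⇒≤ q∣n) , q-prime , q∣n , q-1∣n-1))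
  φ∣n-1 : φ n ∣ n ℕ.∸ 1
  φ∣n-1 = x+unit≈0⇒x∣pred {x = φ n} {u = μ n} 1<n (totient< 1<n) (∣μ∣≡1 sf) (≈-trans (≈-sym S≈φ+μ) S≈0[mod-n])
  korselt-n : Korselt n
  korselt-n q q-prime q∣n = ∣-trans (pred∣totient sf q-prime q∣n) φ∣n-1

weakCarmichael⇒carmichael : ∀ {n} → 1 < n → SquareFree n → WeakCarmichael n → Carmichael n
weakCarmichael⇒carmichael 1<n sf (composite , S≡φ) = composite , λ a gcd≡1 →
  ≈⇒≡[mod] (korselt⇒fermat-congruence (ℕ.m<n⇒0<n 1<n) sf
    (weakCarmichael⇒korselt 1<n sf (≡[mod]⇒≈ S≡φ)) a gcd≡1)

square∣⇒composite : ∀ {n p} → 0 < n → Prime p → p ℕ.* p ∣ n → Composite n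
square∣⇒composite {n} {p} 0<n p-prime p²∣n =
  hasNonTrivialDivisor {{prime⇒nonTrivial p-prime}} p<n (∣-trans (m∣m*n p) p²∣n)
  where
  p<n : p < n
  p<n = ℕ.<-≤-trans (ℕ.m<m*n p p {{prime⇒nonZero p-prime}} (prime⇒2≤ p-prime)) (∣⇒≤ {{ℕ.>-nonZero 0<n}} p²∣n)

corollary2p17 : (n : ℕ) → 1 < n →
    (WeakCarmichael n × ¬ Carmichael n) ⇔ ((+ S n) ≡ (+ φ n) + μ n [mod n ])
corollary2p17 n 1<n with squareFree? n (ℕ.m<n⇒0<n 1<n)
... | inj₁ sf = mk⇔
  (λ (weakCarmichael , ¬carmichael) → ⊥-elim (¬carmichael (weakCarmichael⇒carmichael 1<n sf weakCarmichael)))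
  (λ S≡φ+μ → ⊥-elim (squareFree⇒S≉φ+μ 1<n sf (≡[mod]⇒≈ S≡φ+μ)))
... | inj₂ (p , p-prime , p²∣n) = mk⇔
  (λ ((_ , S≡φ) , _) → subst (λ z → (+ S n) ≡ z [mod n ]) (sym φ+μ≡φ) S≡φ)
  (λ S≡φ+μ → (square∣⇒composite 0<n p-prime p²∣n , subst (λ z → (+ S n) ≡ z [mod n ]) φ+μ≡φ S≡φ+μ)
           , λ (_ , carmichael) → carmichael⇒squareFree 0<n carmichael p p-prime p²∣n)
  where
  0<n = ℕ.m<n⇒0<n 1<n
  φ+μ≡φ : + φ n + μ n ≡ + φ n
  φ+μ≡φ = trans (cong (_+_ (+ φ n)) (μ≡0 0<n p-prime p²∣n)) (ℤ.+-identityʳ (+ φ n))
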